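{- Let $\varphi$ be the Fibonacci substitution $a\mapsto ab$, $b\mapsto a$ on $A=\{a,b\}$, and let $\gamma\in A^{\mathbb{Z}}$ be the two-sided periodic point of $\varphi$ of period $2$ with seed $\gamma_{ -1}|\gamma_0=b|a$. Then $\mathrm{rep}_\gamma=\mathrm{rep}_{\mathcal{F}c}$.
   Context: $\varepsilon$ is the empty word, $|w|$ the length. $\varphi$ acts on $u\in A^{\mathbb{Z}}$ by $\varphi(\cdots u_{ -1}|u_0\cdots)=\cdots\varphi(u_{ -2})\varphi(u_{ -1})|\varphi(u_0)\varphi(u_1)\cdots$ ($|$ separating positions $-1$ and $0$); $u$ is a periodic point of period $p$ if $p$ is the least integer $\ge1$ with $\varphi^p(u)=u$; its seed is $u_{ -1}|u_0$. A sequence $(m_i,a_i)_{i=0,\dots,k}$ in $A^*\times A$ is $x$-admissible if $m_{i-1}a_{i-1}$ is a prefix of $\varphi(a_i)$ for $1\le i\le k$ and $m_ka_k$ is a prefix of $\varphi(x)$. Here $\mathcal{D}=\{0,1\}$ and $\odot$ denotes concatenation. Dumont--Thomas complement system for a periodic point $u$ of period $p$: for $n\ge1$ there are a unique $k$ divisible by $p$ and a unique $u_0$-admissible $(m_i,a_i)_{i=0,\dots,k-1}$ with $m_{k-1}\cdots m_{k-p}\ne\varepsilon$ and $u_0\cdots u_{n-1}=\varphi^{k-1}(m_{k-1})\cdots\varphi^0(m_0)$; for $n\le-2$ there are a unique $k$ divisible by $p$ and a unique $u_{ -1}$-admissible $(m_i,a_i)_{i=0,\dots,k-1}$ with $\varphi^{p-1}(m_{k-1})\cdots\varphi^0(m_{k-p})a_{k-p}\ne\varphi^p(u_{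 -1})$ and $u_{ -|\varphi^k(u_{ -1})|}\cdots u_{n-1}=\varphi^{k-1}(m_{k-1})\cdots\varphi^0(m_0)$. Then $\mathrm{rep}_u(n)=0\odot|m_{k-1}|\odot\cdots\odot|m_0|$ ($n\ge1$), $\mathrm{rep}_u(0)=0$, $\mathrm{rep}_u(-1)=1$, $\mathrm{rep}_u(n)=1\odot|m_{k-1}|\odot\cdots\odot|m_0|$ ($n\le-2$). Fibonacci complement system: $F_0=1$, $F_1=2$, $F_n=F_{n-1}+F_{n-2}$ for $n\ge2$; for $w=w_{k-1}\cdots w_0\in\{0,1\}^k$, $\mathrm{val}_{\mathcal{F}c}(w)=\sum_{i=0}^{k-1}w_iF_i-w_{k-1}F_k$. With $L=\mathcal{D}(\mathcal{D}\mathcal{D})^*\setminus(\mathcal{D}^*11\mathcal{D}^*\cup000\mathcal{D}^*\cup101\mathcal{D}^*)$ (odd-length binary words), for every $n\in\mathbb{Z}$ there is a unique $w\in L$ with $\mathrm{val}_{\mathcal{F}c}(w)=n$, denoted $\mathrm{rep}_{\mathcal{F}c}(n)$. -}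

module Defs where

open import Data.Nat using (ℕ; zero; suc; _+_; _*_; _∸_; _≤_; _<_)
open import Data.Nat.Divisibility using (_∣_)
open import Data.Integer as ℤ using (ℤ; +_; -[1+_])
open import Data.List using (List; []; _∷_; _++_; [_]; length; reverse; concatMap)
open import Data.List.Relation.Unary.All using (All)
open import Data.Product using (Σ; ∃; _×_; _,_)
open import Relation.Binary.PropositionalEquality using (_≡_; _≢_)
open import Relation.Nullary using (¬_)

data A : Set where
  a b : A

φ : A → List A
φ a = a ∷ b ∷ []
φ b = a ∷ []

φw : List A → List A
φw = concatMap φ

φ^ : ℕ → List A → List A
φ^ zero    w = w
φ^ (suc k) w = φw (φ^ k w)

Prefix : List A → List A → Set
Prefix u v = ∃ λ t → u ++ t ≡ v

-- Right half: γ_n is the n-th letter of φ^{n+1}(a) (which has length > n;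
-- the words φ^k(a) are prefixes of one another).
-- Left half: γ_{-(m+1)} is the (m+1)-th letter from the right of
-- φ^{2(m+1)}(b) (which has length > m; the words φ^{2k}(b) are suffixes of
-- one another since φ²(b) = ab ends with b).

-- n-th letter (0-based) of a word; the default is never used below
nth : List A → ℕ → A
nth []      _       = a
nth (x ∷ _) zero    = x
nth (_ ∷ w) (suc n) = nth w n

γ : ℤ → A
γ (+ n)      = nth (φ^ (suc n) [ a ]) n
γ (-[1+ m ]) = nth (reverse (φ^ (2 * suc m) [ b ])) m

seg : ℤ → ℕ → List A
seg lo zero    = []
seg lo (suc ℓ) = γ lo ∷ seg (lo ℤ.+ + 1) ℓ

-- Dumont–Thomas complement system for γ (period p = 2).
-- A sequence (m_i , a_i)_{i=0..k-1} is given by two functions m, as on ℕ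
-- (only indices < k matter).

Admissible : A → ℕ → (ℕ → List A) → (ℕ → A) → Set
Admissible x k m as =
  (∀ i → suc i < k → Prefix (m i ++ [ as i ]) (φ (as (suc i))))
  × Prefix (m (k ∸ 1) ++ [ as (k ∸ 1) ]) (φ x)

expand : (ℕ → List A) → ℕ → List A
expand m zero    = []
expand m (suc j) = φ^ j (m j) ++ expand m j

digits : (ℕ → List A) → ℕ → List ℕ
digits m zero    = []
digits m (suc j) = length (m j) ∷ digits m j

data RepGamma : ℤ → List ℕ → Set where
  rep-zero   : RepGamma (+ 0) (0 ∷ [])
  rep-minus1 : RepGamma (-[1+ 0 ]) (1 ∷ [])
  rep-pos    : ∀ (n k : ℕ) (m : ℕ → List A) (as : ℕ → A) →
               2 ∣ k → 2 ≤ k →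
               Admissible (γ (+ 0)) k m as →
               m (k ∸ 1) ++ m (k ∸ 2) ≢ [] →
               seg (+ 0) (suc n) ≡ expand m k →
               RepGamma (+ suc n) (0 ∷ digits m k)
  rep-neg    : ∀ (n k ℓ : ℕ) (m : ℕ → List A) (as : ℕ → A) →
               2 ∣ k → 2 ≤ k →
               Admissible (γ (-[1+ 0 ])) k m as →
               φ^ 1 (m (k ∸ 1)) ++ φ^ 0 (m (k ∸ 2)) ++ [ as (k ∸ 2) ]
                 ≢ φ^ 2 [ γ (-[1+ 0 ]) ] →
               -- u_{-|φ^k(u_{-1})|} ⋯ u_{n-1} has length ℓ, with n = -[1+ suc n]
               -[1+ suc n ] ≡ ℤ.- (+ length (φ^ k [ γ (-[1+ 0 ]) ])) ℤ.+ + ℓ →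
               seg (ℤ.- (+ length (φ^ k [ γ (-[1+ 0 ]) ]))) ℓ ≡ expand m k →
               RepGamma (-[1+ suc n ]) (1 ∷ digits m k)

F : ℕ → ℕ
F zero          = 1
F (suc zero)    = 2
F (suc (suc n)) = F (suc n) + F n

-- Σ_{i} w_i F_i  for w = w_{k-1} ⋯ w_0 (head is the most significant digit)
valNat : List ℕ → ℕ
valNat []       = 0
valNat (d ∷ ds) = d * F (length ds) + valNat ds

valFc : List ℕ → ℤ
valFc []       = + 0
valFc (d ∷ ds) = + valNat (d ∷ ds) ℤ.- + (d * F (suc (length ds)))

InL : List ℕ → Set
InL w =
  All (_≤ 1) w
  × (∃ λ j → length w ≡ suc (2 * j))
  × ¬ (∃ λ u → ∃ λ v → w ≡ u ++ 1 ∷ 1 ∷ v)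
  × ¬ (∃ λ v → w ≡ 0 ∷ 0 ∷ 0 ∷ v)
  × ¬ (∃ λ v → w ≡ 1 ∷ 0 ∷ 1 ∷ v)

RepFc : ℤ → List ℕ → Set
RepFc n w = InL w × valFc w ≡ n

{-# OPTIONS --safe #-}
module Submission where

-- A pair (m, c) with m c a prefix of φ(y) is either (ε, a) or (a, b), the latter only for y = a.
-- Hence the digit words |m_{k-1}| ⋯ |m_0| of admissible sequences are exactly the binary words
-- without factor 11, and since |φ^j(a)| = F_j the word φ^{k-1}(m_{k-1}) ⋯ φ^0(m_0) has length
-- Σ d_i F_i.  On the right, this word is a prefix of φ^k(a), i.e. of γ_0 γ_1 ⋯, so it is
-- γ_0 ⋯ γ_{n-1} with n = Σ d_i F_i = val_Fc(0 d).  On the left, φ^k(b) = γ_{-|φ^k(b)|} ⋯ γ_{-1}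
-- for even k, |φ^k(b)| = F_{k-1}, and m_{k-1} = ε since φ(b) = a; so n = Σ d_i F_i − F_{k-1}
-- = val_Fc(1 d).  The uniqueness side conditions of the two systems match: on the right
-- m_{k-1} m_{k-2} ≠ ε excludes the prefix 000, and φ(m_{k-1}) m_{k-2} a_{k-2} ≠ φ²(b) excludes 101.

open import Defs
open import Data.Empty using (⊥-elim)
open import Data.Integer as Z using (ℤ; +_; -[1+_]; _⊖_)
import Data.Integer.Properties as ZP
open import Data.List using (List; []; _∷_; _++_; [_]; length; reverse)
import Data.List.Properties as LP
open import Data.List.Relation.Unary.All using (All; []; _∷_)
open import Data.Nat as N
  using (ℕ; zero; suc; pred; _+_; _*_; _∸_; _≤_; _<_; _≤′_; ≤′-refl; ≤′-step; z≤n; s≤s; >-nonZero)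
import Data.Nat.Properties as NP
open import Data.Nat.Divisibility using (_∣_; divides; ∣1⇒≡1)
open import Data.Product using (∃; _×_; _,_; proj₁; proj₂)
open import Data.Sum using (_⊎_; inj₁; inj₂)
open import Function using (_∘_)
open import Function.Bundles using (_⇔_; mk⇔)
open import Relation.Binary.PropositionalEquality hiding ([_])
open import Relation.Nullary using (¬_; yes; no)

φw-++ : ∀ u v → φw (u ++ v) ≡ φw u ++ φw v
φw-++ []      v = refl
φw-++ (x ∷ u) v = trans (cong (φ x ++_) (φw-++ u v)) (sym (LP.++-assoc (φ x) (φw u) (φw v)))

φ^-++ : ∀ j u v → φ^ j (u ++ v) ≡ φ^ j u ++ φ^ j v
φ^-++ zero    u v = refl
φ^-++ (suc j) u v = trans (cong φw (φ^-++ j u v)) (φw-++ (φ^ j u) (φ^ j v))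

φ^-[] : ∀ j → φ^ j [] ≡ []
φ^-[] zero    = refl
φ^-[] (suc j) = cong φw (φ^-[] j)

φ^-suc : ∀ j w → φ^ (suc j) w ≡ φ^ j (φw w)
φ^-suc zero    w = refl
φ^-suc (suc j) w = cong φw (φ^-suc j w)

φ^-b : ∀ j → φ^ (suc j) [ b ] ≡ φ^ j [ a ]
φ^-b j = φ^-suc j [ b ]

φ^-a-split : ∀ j → φ^ (2 + j) [ a ] ≡ φ^ (suc j) [ a ] ++ φ^ j [ a ]
φ^-a-split j = begin
  φ^ (2 + j) [ a ]                      ≡⟨ φ^-suc (suc j) [ a ] ⟩
  φ^ (suc j) ([ a ] ++ [ b ])           ≡⟨ φ^-++ (suc j) [ a ] [ b ] ⟩
  φ^ (suc j) [ a ] ++ φ^ (suc j) [ b ]  ≡⟨ cong (φ^ (suc j) [ a ] ++_) (φ^-b j) ⟩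
  φ^ (suc j) [ a ] ++ φ^ j [ a ]        ∎
  where open ≡-Reasoning

φ^-b-split : ∀ j → φ^ (2 + j) [ b ] ≡ φ^ j [ a ] ++ φ^ j [ b ]
φ^-b-split j = begin
  φ^ (2 + j) [ b ]          ≡⟨ φ^-b (suc j) ⟩
  φ^ (suc j) [ a ]          ≡⟨ φ^-suc j [ a ] ⟩
  φ^ j ([ a ] ++ [ b ])     ≡⟨ φ^-++ j [ a ] [ b ] ⟩
  φ^ j [ a ] ++ φ^ j [ b ]  ∎
  where open ≡-Reasoning

length-φ^-a : ∀ j → length (φ^ j [ a ]) ≡ F j
length-φ^-a zero          = refl
length-φ^-a (suc zero)    = refl
length-φ^-a (suc (suc j)) = begin
  length (φ^ (2 + j) [ a ])                             ≡⟨ cong length (φ^-a-split j) ⟩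
  length (φ^ (suc j) [ a ] ++ φ^ j [ a ])               ≡⟨ LP.length-++ (φ^ (suc j) [ a ]) ⟩
  length (φ^ (suc j) [ a ]) + length (φ^ j [ a ])       ≡⟨ cong₂ _+_ (length-φ^-a (suc j)) (length-φ^-a j) ⟩
  F (suc j) + F j                                       ∎
  where open ≡-Reasoning

length-φ^-b : ∀ j → length (φ^ (suc j) [ b ]) ≡ F j
length-φ^-b j = trans (cong length (φ^-b j)) (length-φ^-a j)

F-pos : ∀ n → 0 < F n
F-pos zero          = s≤s z≤n
F-pos (suc zero)    = s≤s z≤n
F-pos (suc (suc n)) = NP.<-≤-trans (F-pos (suc n)) (NP.m≤m+n _ _)

F-<-suc : ∀ n → F n < F (suc n)
F-<-suc zero          = s≤s (s≤s z≤n)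
F-<-suc (suc zero)    = s≤s (s≤s (s≤s z≤n))
F-<-suc (suc (suc n)) = NP.m<m+n (F (suc (suc n))) (F-pos (suc n))

n<F : ∀ n → n < F n
n<F zero    = s≤s z≤n
n<F (suc n) = NP.<-≤-trans (s≤s (n<F n)) (F-<-suc n)

Prefix-trans : ∀ {u v w} → Prefix u v → Prefix v w → Prefix u w
Prefix-trans {u} (t , refl) (s , refl) = t ++ s , sym (LP.++-assoc u t s)

Prefix-++ˡ : ∀ p {u v} → Prefix u v → Prefix (p ++ u) (p ++ v)
Prefix-++ˡ p {u} (t , refl) = t , LP.++-assoc p u t

φ^-Prefix : ∀ j {u v} → Prefix u v → Prefix (φ^ j u) (φ^ j v)
φ^-Prefix j {u} (t , refl) = φ^ j t , sym (φ^-++ j u t)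

φ^-a-Prefix-suc : ∀ j → Prefix (φ^ j [ a ]) (φ^ (suc j) [ a ])
φ^-a-Prefix-suc zero    = [ b ] , refl
φ^-a-Prefix-suc (suc j) = φ^ j [ a ] , sym (φ^-a-split j)

φ^-a-Prefix : ∀ {i j} → i ≤′ j → Prefix (φ^ i [ a ]) (φ^ j [ a ])
φ^-a-Prefix ≤′-refl          = [] , LP.++-identityʳ _
φ^-a-Prefix (≤′-step {j} i≤j) = Prefix-trans (φ^-a-Prefix i≤j) (φ^-a-Prefix-suc j)

Suffix : List A → List A → Set
Suffix u v = ∃ λ p → p ++ u ≡ v

Suffix-trans : ∀ {u v w} → Suffix u v → Suffix v w → Suffix u w
Suffix-trans {u} (p , refl) (q , refl) = q ++ p , LP.++-assoc q p u

Suffix⇒Prefix-reverse : ∀ {u v} → Suffix u v → Prefix (reverse u) (reverse v)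
Suffix⇒Prefix-reverse {u} (p , refl) = reverse p , sym (LP.reverse-++ p u)

-- φ²(b) = ab ends with b, so the words φ^{2i}(b) are suffixes of one another.
φ^-b-Suffix : ∀ {i j} → i ≤′ j → Suffix (φ^ (2 * i) [ b ]) (φ^ (2 * j) [ b ])
φ^-b-Suffix ≤′-refl           = [] , refl
φ^-b-Suffix (≤′-step {j} i≤j) = Suffix-trans (φ^-b-Suffix i≤j)
  (φ^ (2 * j) [ a ] , sym (trans (cong (λ n → φ^ n [ b ]) (NP.*-suc 2 j)) (φ^-b-split (2 * j))))

nth-++-∷ : ∀ u x v → nth (u ++ x ∷ v) (length u) ≡ x
nth-++-∷ []      x v = refl
nth-++-∷ (y ∷ u) x v = nth-++-∷ u x v

nth-Prefix : ∀ {u v} i → Prefix u v → i < length u → nth u i ≡ nth v i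
nth-Prefix {x ∷ u} zero    (t , refl) _         = refl
nth-Prefix {x ∷ u} (suc i) (t , refl) (s≤s i<) = nth-Prefix {u} i (t , refl) i<

nth-reverse-++-∷ : ∀ u x v → nth (reverse (u ++ x ∷ v)) (length v) ≡ x
nth-reverse-++-∷ u x v = begin
  nth (reverse (u ++ x ∷ v)) (length v)                   ≡⟨ cong (λ w → nth w (length v)) (LP.reverse-++ u (x ∷ v)) ⟩
  nth (reverse (x ∷ v) ++ reverse u) (length v)           ≡⟨ cong (λ w → nth (w ++ reverse u) (length v)) (LP.unfold-reverse x v) ⟩
  nth ((reverse v ++ [ x ]) ++ reverse u) (length v)      ≡⟨ cong (λ w → nth w (length v)) (LP.++-assoc (reverse v) [ x ] (reverse u)) ⟩
  nth (reverse v ++ x ∷ reverse u) (length v)             ≡⟨ cong (nth (reverse v ++ x ∷ reverse u)) (sym (LP.length-reverse v)) ⟩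
  nth (reverse v ++ x ∷ reverse u) (length (reverse v))   ≡⟨ nth-++-∷ (reverse v) x (reverse u) ⟩
  x                                                       ∎
  where open ≡-Reasoning

length<length-++-∷ˡ : ∀ u (x : A) v → length u < length (u ++ x ∷ v)
length<length-++-∷ˡ []      x v = s≤s z≤n
length<length-++-∷ˡ (y ∷ u) x v = s≤s (length<length-++-∷ˡ u x v)

length<length-++-∷ʳ : ∀ u (x : A) v → length v < length (u ++ x ∷ v)
length<length-++-∷ʳ []      x v = NP.n<1+n (length v)
length<length-++-∷ʳ (y ∷ u) x v = NP.m<n⇒m<1+n (length<length-++-∷ʳ u x v)

-[m+1+n]+m≡-[1+n] : ∀ m n → Z.- (+ (m + suc n)) Z.+ + m ≡ -[1+ n ]
-[m+1+n]+m≡-[1+n] m n = begin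
  Z.- (+ (m + suc n)) Z.+ + m  ≡⟨ ZP.-m+n≡n⊖m (m + suc n) m ⟩
  m ⊖ (m + suc n)              ≡⟨ cong (_⊖ (m + suc n)) (sym (NP.+-identityʳ m)) ⟩
  (m + 0) ⊖ (m + suc n)        ≡⟨ ZP.+-cancelˡ-⊖ m 0 (suc n) ⟩
  -[1+ n ]                     ∎
  where open ≡-Reasoning

γ-+≡nth-φ^-a : ∀ K i → i < length (φ^ K [ a ]) → γ (+ i) ≡ nth (φ^ K [ a ]) i
γ-+≡nth-φ^-a K i i<K with NP.≤-total (suc i) K
... | inj₁ 1+i≤K = nth-Prefix i (φ^-a-Prefix (NP.≤⇒≤′ 1+i≤K))
                     (subst (i <_) (sym (length-φ^-a (suc i))) (NP.<-trans (n<F i) (F-<-suc i)))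
... | inj₂ K≤1+i = sym (nth-Prefix i (φ^-a-Prefix (NP.≤⇒≤′ K≤1+i)) i<K)

γ-[1+]≡nth-reverse-φ^-b : ∀ j r → r < length (φ^ (2 * j) [ b ]) →
               γ -[1+ r ] ≡ nth (reverse (φ^ (2 * j) [ b ])) r
γ-[1+]≡nth-reverse-φ^-b j r r<j with NP.≤-total (suc r) j
... | inj₁ 1+r≤j = nth-Prefix r (Suffix⇒Prefix-reverse (φ^-b-Suffix (NP.≤⇒≤′ 1+r≤j))) r<
  where
  r< : r < length (reverse (φ^ (2 * suc r) [ b ]))
  r< = subst (r <_) (sym (trans (LP.length-reverse (φ^ (2 * suc r) [ b ]))
                                (trans (cong (λ n → length (φ^ n [ b ])) (NP.*-suc 2 r)) (length-φ^-b (suc (2 * r))))))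
         (NP.≤-<-trans (NP.≤-trans (NP.m≤m+n r (r + 0)) (NP.n≤1+n _)) (n<F (suc (2 * r))))
... | inj₂ j≤1+r = sym (nth-Prefix r (Suffix⇒Prefix-reverse (φ^-b-Suffix (NP.≤⇒≤′ j≤1+r)))
                         (subst (r <_) (sym (LP.length-reverse (φ^ (2 * j) [ b ]))) r<j))

γ-at-φ^-a : ∀ K u x t → u ++ x ∷ t ≡ φ^ K [ a ] → γ (+ length u) ≡ x
γ-at-φ^-a K u x t eq = begin
  γ (+ length u)                  ≡⟨ γ-+≡nth-φ^-a K (length u) (subst (λ w → length u < length w) eq (length<length-++-∷ˡ u x t)) ⟩
  nth (φ^ K [ a ]) (length u)     ≡⟨ cong (λ w → nth w (length u)) (sym eq) ⟩
  nth (u ++ x ∷ t) (length u)     ≡⟨ nth-++-∷ u x t ⟩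
  x                               ∎
  where open ≡-Reasoning

γ-at-φ^-b : ∀ j u x t → u ++ x ∷ t ≡ φ^ (2 * j) [ b ] →
            γ (Z.- (+ length (φ^ (2 * j) [ b ])) Z.+ + length u) ≡ x
γ-at-φ^-b j u x t eq = begin
  γ (Z.- (+ length W) Z.+ + length u)               ≡⟨ cong (λ w → γ (Z.- (+ length w) Z.+ + length u)) (sym eq) ⟩
  γ (Z.- (+ length (u ++ x ∷ t)) Z.+ + length u)    ≡⟨ cong (λ n → γ (Z.- (+ n) Z.+ + length u)) (LP.length-++ u) ⟩
  γ (Z.- (+ (length u + suc (length t))) Z.+ + length u)
                                                    ≡⟨ cong γ (-[m+1+n]+m≡-[1+n] (length u) (length t)) ⟩
  γ -[1+ length t ]                                 ≡⟨ γ-[1+]≡nth-reverse-φ^-b j (length t) (subst (λ w → length t < length w) eq (length<length-++-∷ʳ u x t)) ⟩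
  nth (reverse W) (length t)                        ≡⟨ cong (λ w → nth (reverse w) (length t)) (sym eq) ⟩
  nth (reverse (u ++ x ∷ t)) (length t)             ≡⟨ nth-reverse-++-∷ u x t ⟩
  x                                                 ∎
  where
  open ≡-Reasoning
  W = φ^ (2 * j) [ b ]

seg-factor : ∀ lo W → (∀ u x t → u ++ x ∷ t ≡ W → γ (lo Z.+ + length u) ≡ x) →
             ∀ u e t → u ++ e ++ t ≡ W → seg (lo Z.+ + length u) (length e) ≡ e
seg-factor lo W γ-at u []      t eq = refl
seg-factor lo W γ-at u (x ∷ e) t eq = cong₂ _∷_ (γ-at u x (e ++ t) eq) (begin
  seg (lo Z.+ + length u Z.+ + 1) (length e)   ≡⟨ cong (λ i → seg i (length e)) shift ⟩
  seg (lo Z.+ + length (u ++ [ x ])) (length e) ≡⟨ seg-factor lo W γ-at (u ++ [ x ]) e t eq′ ⟩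
  e                                            ∎)
  where
  open ≡-Reasoning
  shift : lo Z.+ + length u Z.+ + 1 ≡ lo Z.+ + length (u ++ [ x ])
  shift = trans (ZP.+-assoc lo (+ length u) (+ 1)) (cong (λ n → lo Z.+ + n) (sym (LP.length-++ u)))
  eq′ : (u ++ [ x ]) ++ e ++ t ≡ W
  eq′ = trans (LP.++-assoc u [ x ] (e ++ t)) eq

seg-Prefix-φ^-a : ∀ K {e} → Prefix e (φ^ K [ a ]) → seg (+ 0) (length e) ≡ e
seg-Prefix-φ^-a K {e} (t , eq) = seg-factor (+ 0) (φ^ K [ a ]) (γ-at-φ^-a K) [] e t eq

seg-Prefix-φ^-b : ∀ j {e} → Prefix e (φ^ (2 * j) [ b ]) →
                  seg (Z.- (+ length (φ^ (2 * j) [ b ]))) (length e) ≡ e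
seg-Prefix-φ^-b j {e} (t , eq) =
  subst (λ i → seg i (length e) ≡ e) (ZP.+-identityʳ _)
    (seg-factor (Z.- (+ length (φ^ (2 * j) [ b ]))) (φ^ (2 * j) [ b ]) (γ-at-φ^-b j) [] e t eq)

data Zeckendorf : List ℕ → Set where
  ε    : Zeckendorf []
  0∷_  : ∀ {ds} → Zeckendorf ds → Zeckendorf (0 ∷ ds)
  1ε   : Zeckendorf (1 ∷ [])
  10∷_ : ∀ {ds} → Zeckendorf ds → Zeckendorf (1 ∷ 0 ∷ ds)

Zeckendorf-tail : ∀ {d ds} → Zeckendorf (d ∷ ds) → Zeckendorf ds
Zeckendorf-tail (0∷ z)  = z
Zeckendorf-tail 1ε      = ε
Zeckendorf-tail (10∷ z) = 0∷ z

Zeckendorf⇒All≤1 : ∀ {w} → Zeckendorf w → All (_≤ 1) w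
Zeckendorf⇒All≤1 ε       = []
Zeckendorf⇒All≤1 (0∷ z)  = z≤n ∷ Zeckendorf⇒All≤1 z
Zeckendorf⇒All≤1 1ε      = s≤s z≤n ∷ []
Zeckendorf⇒All≤1 (10∷ z) = s≤s z≤n ∷ z≤n ∷ Zeckendorf⇒All≤1 z

NoFactor11 : List ℕ → Set
NoFactor11 w = ¬ (∃ λ u → ∃ λ v → w ≡ u ++ 1 ∷ 1 ∷ v)

Zeckendorf⇒NoFactor11 : ∀ {w} → Zeckendorf w → NoFactor11 w
Zeckendorf⇒NoFactor11 ε       ([] , v , ())
Zeckendorf⇒NoFactor11 ε       (_ ∷ u , v , ())
Zeckendorf⇒NoFactor11 (0∷ z)  ([] , v , ())
Zeckendorf⇒NoFactor11 (0∷ z)  (_ ∷ u , v , refl) = Zeckendorf⇒NoFactor11 z (u , v , refl)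
Zeckendorf⇒NoFactor11 1ε      ([] , v , ())
Zeckendorf⇒NoFactor11 1ε      (_ ∷ [] , v , ())
Zeckendorf⇒NoFactor11 1ε      (_ ∷ _ ∷ u , v , ())
Zeckendorf⇒NoFactor11 (10∷ z) ([] , v , ())
Zeckendorf⇒NoFactor11 (10∷ z) (_ ∷ [] , v , ())
Zeckendorf⇒NoFactor11 (10∷ z) (_ ∷ _ ∷ u , v , refl) = Zeckendorf⇒NoFactor11 z (u , v , refl)

All≤1∧NoFactor11⇒Zeckendorf : ∀ w → All (_≤ 1) w → NoFactor11 w → Zeckendorf w
All≤1∧NoFactor11⇒Zeckendorf [] _ _ = ε
All≤1∧NoFactor11⇒Zeckendorf (zero ∷ w) (_ ∷ ≤1) no11 =
  0∷ All≤1∧NoFactor11⇒Zeckendorf w ≤1 (λ { (u , v , eq) → no11 (0 ∷ u , v , cong (0 ∷_) eq) })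
All≤1∧NoFactor11⇒Zeckendorf (suc zero ∷ []) _ _ = 1ε
All≤1∧NoFactor11⇒Zeckendorf (suc zero ∷ zero ∷ w) (_ ∷ _ ∷ ≤1) no11 =
  10∷ All≤1∧NoFactor11⇒Zeckendorf w ≤1 (λ { (u , v , eq) → no11 (1 ∷ 0 ∷ u , v , cong (λ w → 1 ∷ 0 ∷ w) eq) })
All≤1∧NoFactor11⇒Zeckendorf (suc zero ∷ suc zero ∷ w) _ no11 = ⊥-elim (no11 ([] , w , refl))
All≤1∧NoFactor11⇒Zeckendorf (suc zero ∷ suc (suc _) ∷ w) (_ ∷ s≤s () ∷ _) _
All≤1∧NoFactor11⇒Zeckendorf (suc (suc _) ∷ w) (s≤s () ∷ _) _

valNat-Zeckendorf< : ∀ {w} → Zeckendorf w → valNat w < F (length w)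
valNat-Zeckendorf< ε               = s≤s z≤n
valNat-Zeckendorf< (0∷_ {ds} z)    = NP.<-trans (valNat-Zeckendorf< z) (F-<-suc (length ds))
valNat-Zeckendorf< 1ε              = s≤s (s≤s z≤n)
valNat-Zeckendorf< (10∷_ {ds} z) rewrite NP.+-identityʳ (F (suc (length ds))) =
  NP.+-monoʳ-< (F (suc (length ds))) (valNat-Zeckendorf< z)

valNat-pos : ∀ d ds → 0 < d → 0 < valNat (d ∷ ds)
valNat-pos (suc d) ds _ = NP.<-≤-trans (F-pos (length ds)) (NP.≤-trans (NP.m≤m+n _ _) (NP.m≤m+n _ _))

length-digits : ∀ m j → length (digits m j) ≡ j
length-digits m zero    = refl
length-digits m (suc j) = cong suc (length-digits m j)

PairShape : List A → A → Set
PairShape mm c = (mm ≡ [] × c ≡ a) ⊎ (mm ≡ [ a ] × c ≡ b)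

pair-shape : ∀ {mm c} y → Prefix (mm ++ [ c ]) (φ y) → PairShape mm c
pair-shape {[]}               a (t , refl) = inj₁ (refl , refl)
pair-shape {[]}               b (t , refl) = inj₁ (refl , refl)
pair-shape {_ ∷ []}           a (t , refl) = inj₂ (refl , refl)
pair-shape {_ ∷ []}           b (t , ())
pair-shape {_ ∷ _ ∷ []}       a (t , ())
pair-shape {_ ∷ _ ∷ []}       b (t , ())
pair-shape {_ ∷ _ ∷ _ ∷ _}    a (t , ())
pair-shape {_ ∷ _ ∷ _ ∷ _}    b (t , ())

pair-shape-b : ∀ {mm c} → Prefix (mm ++ [ c ]) (φ b) → mm ≡ []
pair-shape-b {[]}        _        = refl
pair-shape-b {_ ∷ []}    (t , ())
pair-shape-b {_ ∷ _ ∷ _} (t , ())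

length-φ^-block : ∀ j {mm c} → PairShape mm c → length (φ^ j mm) ≡ length mm * F j
length-φ^-block j (inj₁ (refl , _)) = cong length (φ^-[] j)
length-φ^-block j (inj₂ (refl , _)) = trans (length-φ^-a j) (sym (NP.*-identityˡ (F j)))

expand-∷ʳ-Prefix-suc : ∀ (m : ℕ → List A) (as : ℕ → A) j y →
                       Prefix (expand m j ++ [ as 0 ]) (φ^ j [ as j ]) →
                       Prefix (m j ++ [ as j ]) (φ y) →
                       Prefix (expand m (suc j) ++ [ as 0 ]) (φ^ (suc j) [ y ])
expand-∷ʳ-Prefix-suc m as j y below top =
  subst₂ Prefix (sym (LP.++-assoc (φ^ j (m j)) (expand m j) [ as 0 ])) φ^-φ
    (Prefix-trans (Prefix-++ˡ (φ^ j (m j)) below)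
      (subst (λ w → Prefix w (φ^ j (φ y))) (φ^-++ j (m j) [ as j ]) (φ^-Prefix j top)))
  where
  φ^-φ : φ^ j (φ y) ≡ φ^ (suc j) [ y ]
  φ^-φ = trans (cong (φ^ j) (sym (LP.++-identityʳ (φ y)))) (sym (φ^-suc j [ y ]))

module AdmissibleSequence {x : A} {k : ℕ} {m : ℕ → List A} {as : ℕ → A} (adm : Admissible x k m as) where

  pair-shape-at : ∀ i → i < k → PairShape (m i) (as i)
  pair-shape-at i i<k with NP.m≤n⇒m<n∨m≡n i<k
  ... | inj₁ 1+i<k = pair-shape (as (suc i)) (proj₁ adm i 1+i<k)
  ... | inj₂ refl  = pair-shape x (proj₂ adm)

  m-below-b : ∀ j → suc j < k → as (suc j) ≡ b → m j ≡ []
  m-below-b j 1+j<k as≡b = pair-shape-b (subst (λ y → Prefix (m j ++ [ as j ]) (φ y)) as≡b (proj₁ adm j 1+j<k))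

  1∷digits-Zeckendorf : ∀ j → j < k → as j ≡ b → Zeckendorf (digits m j) → Zeckendorf (1 ∷ digits m j)
  1∷digits-Zeckendorf zero    _   _    _ = 1ε
  1∷digits-Zeckendorf (suc j) j<k as≡b z =
    subst (λ w → Zeckendorf (1 ∷ length w ∷ digits m j)) (sym (m-below-b j j<k as≡b)) (10∷ Zeckendorf-tail z)

  digits-Zeckendorf : ∀ j → j ≤ k → Zeckendorf (digits m j)
  digits-Zeckendorf zero    _   = ε
  digits-Zeckendorf (suc j) j<k with pair-shape-at j j<k
  ... | inj₁ (m≡[] , _) = subst (λ w → Zeckendorf (length w ∷ digits m j)) (sym m≡[])
                            (0∷ digits-Zeckendorf j (NP.<⇒≤ j<k))
  ... | inj₂ (m≡a , as≡b) = subst (λ w → Zeckendorf (length w ∷ digits m j)) (sym m≡a)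
                              (1∷digits-Zeckendorf j j<k as≡b (digits-Zeckendorf j (NP.<⇒≤ j<k)))

  length-expand : ∀ j → j ≤ k → length (expand m j) ≡ valNat (digits m j)
  length-expand zero    _   = refl
  length-expand (suc j) j<k = begin
    length (φ^ j (m j) ++ expand m j)              ≡⟨ LP.length-++ (φ^ j (m j)) ⟩
    length (φ^ j (m j)) + length (expand m j)      ≡⟨ cong₂ _+_ (length-φ^-block j (pair-shape-at j j<k))
                                                              (length-expand j (NP.<⇒≤ j<k)) ⟩
    length (m j) * F j + valNat (digits m j)       ≡⟨ cong (λ n → length (m j) * F n + valNat (digits m j))
                                                           (sym (length-digits m j)) ⟩
    valNat (digits m (suc j))                      ∎
    where open ≡-Reasoning

  expand-∷ʳ-Prefix : ∀ j → j < k → Prefix (expand m j ++ [ as 0 ]) (φ^ j [ as j ])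
  expand-∷ʳ-Prefix zero    _     = [] , refl
  expand-∷ʳ-Prefix (suc j) 1+j<k =
    expand-∷ʳ-Prefix-suc m as j (as (suc j)) (expand-∷ʳ-Prefix j (NP.<-trans (NP.n<1+n j) 1+j<k)) (proj₁ adm j 1+j<k)

expand-Prefix : ∀ x {k m as} → Admissible x k m as → Prefix (expand m k) (φ^ k [ x ])
expand-Prefix x {zero}    _   = [ x ] , refl
expand-Prefix x {suc k} {m} {as} adm with expand-∷ʳ-Prefix-suc m as k x
                                               (AdmissibleSequence.expand-∷ʳ-Prefix adm k (NP.n<1+n k)) (proj₂ adm)
... | t , eq = [ as 0 ] ++ t , trans (sym (LP.++-assoc (expand m (suc k)) [ as 0 ] t)) eq

-- The digit of weight F_i, i.e. the i-th digit counted from the right.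
digit : List ℕ → ℕ → ℕ
digit []       i = 0
digit (d ∷ ds) i with i N.≟ length ds
... | yes _ = d
... | no  _ = digit ds i

digit-top : ∀ d ds → digit (d ∷ ds) (length ds) ≡ d
digit-top d ds with length ds N.≟ length ds
... | yes _  = refl
... | no  ≢ = ⊥-elim (≢ refl)

digit-below : ∀ d ds {i} → i < length ds → digit (d ∷ ds) i ≡ digit ds i
digit-below d ds {i} i<ds with i N.≟ length ds
... | yes refl = ⊥-elim (NP.<-irrefl refl i<ds)
... | no  _    = refl

digit-after-1 : ∀ {ds} i → Zeckendorf ds → suc i < length ds → digit ds i ≢ 0 → digit ds (suc i) ≡ 0
digit-after-1 {d ∷ ds} i z (s≤s 1+i≤ds) ≢0 with NP.m≤n⇒m<n∨m≡n 1+i≤ds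
... | inj₁ 1+i<ds = trans (digit-below d ds 1+i<ds)
                      (digit-after-1 i (Zeckendorf-tail z) 1+i<ds (≢0 ∘ trans (digit-below d ds (NP.<-trans (NP.n<1+n i) 1+i<ds))))
digit-after-1 {d ∷ e ∷ ds} i z (s≤s _) ≢0 | inj₂ refl =
  trans (digit-top d (e ∷ ds)) (top-0 z (≢0 ∘ trans (trans (digit-below d (e ∷ ds) (NP.n<1+n i)) (digit-top e ds))))
  where
  top-0 : Zeckendorf (d ∷ e ∷ ds) → e ≢ 0 → d ≡ 0
  top-0 (0∷ _)  _  = refl
  top-0 (10∷ _) e≢0 = ⊥-elim (e≢0 refl)

-- The inverse of pair-shape: digit 0 gives the pair (ε, a), digit 1 the pair (a, b).
block : ℕ → List A
block zero    = []
block (suc _) = [ a ]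

letter : ℕ → A
letter zero    = a
letter (suc _) = b

mSeq : List ℕ → ℕ → List A
mSeq ds i = block (digit ds i)

aSeq : List ℕ → ℕ → A
aSeq ds i = letter (digit ds i)

digits-cong : ∀ m m′ j → (∀ i → i < j → m i ≡ m′ i) → digits m j ≡ digits m′ j
digits-cong m m′ zero    _  = refl
digits-cong m m′ (suc j) m≗ = cong₂ _∷_ (cong length (m≗ j (NP.n<1+n j)))
                                       (digits-cong m m′ j (λ i i<j → m≗ i (NP.<-trans i<j (NP.n<1+n j))))

length-block : ∀ d → d ≤ 1 → length (block d) ≡ d
length-block zero          _         = refl
length-block (suc zero)    _         = refl
length-block (suc (suc _)) (s≤s ())

digits-mSeq : ∀ ds → All (_≤ 1) ds → digits (mSeq ds) (length ds) ≡ ds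
digits-mSeq []       _          = refl
digits-mSeq (d ∷ ds) (d≤1 ∷ ≤1) = cong₂ _∷_
  (trans (cong (length ∘ block) (digit-top d ds)) (length-block d d≤1))
  (trans (digits-cong (mSeq (d ∷ ds)) (mSeq ds) (length ds) (λ i i<ds → cong block (digit-below d ds i<ds)))
         (digits-mSeq ds ≤1))

[a]-Prefix-φ : ∀ y → Prefix [ a ] (φ y)
[a]-Prefix-φ a = [ b ] , refl
[a]-Prefix-φ b = [] , refl

block-letter-Prefix-φa : ∀ d → Prefix (block d ++ [ letter d ]) (φ a)
block-letter-Prefix-φa zero    = [ b ] , refl
block-letter-Prefix-φa (suc _) = [] , refl

mSeq-pair-Prefix : ∀ {ds} i → Zeckendorf ds → suc i < length ds →
                   Prefix (mSeq ds i ++ [ aSeq ds i ]) (φ (aSeq ds (suc i)))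
mSeq-pair-Prefix {ds} i z 1+i<ds with digit ds i in eq
... | zero  = [a]-Prefix-φ _
... | suc _ rewrite digit-after-1 i z 1+i<ds (NP.1+n≢0 ∘ trans (sym eq)) = [] , refl

mSeq-Admissible : ∀ x d ds → Zeckendorf (d ∷ ds) → Prefix (block d ++ [ letter d ]) (φ x) →
                  Admissible x (length (d ∷ ds)) (mSeq (d ∷ ds)) (aSeq (d ∷ ds))
mSeq-Admissible x d ds z top =
  (λ i 1+i<k → mSeq-pair-Prefix i z 1+i<k) ,
  subst (λ e → Prefix (block e ++ [ letter e ]) (φ x)) (sym (digit-top d ds)) top

length-expand-mSeq : ∀ x {ds} → Admissible x (length ds) (mSeq ds) (aSeq ds) → All (_≤ 1) ds →
                     length (expand (mSeq ds) (length ds)) ≡ valNat ds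
length-expand-mSeq x {ds} adm ≤1 =
  trans (AdmissibleSequence.length-expand adm (length ds) NP.≤-refl) (cong valNat (digits-mSeq ds ≤1))

length-seg : ∀ lo ℓ → length (seg lo ℓ) ≡ ℓ
length-seg lo zero    = refl
length-seg lo (suc ℓ) = cong suc (length-seg (lo Z.+ + 1) ℓ)

valFc-0∷ : ∀ ds → valFc (0 ∷ ds) ≡ + valNat ds
valFc-0∷ ds = cong +_ (NP.+-identityʳ (valNat ds))

valFc-1∷ : ∀ ds {j} → length ds ≡ suc j → valFc (1 ∷ ds) ≡ Z.- (+ F j) Z.+ + valNat ds
valFc-1∷ ds {j} ds≡ rewrite ds≡ = begin
  + (1 * F (suc j) + valNat ds) Z.- + (1 * F (2 + j))   ≡⟨ ZP.m-n≡m⊖n (1 * F (suc j) + valNat ds) (1 * F (2 + j)) ⟩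
  (1 * F (suc j) + valNat ds) ⊖ (1 * F (2 + j))         ≡⟨ cong₂ _⊖_ (cong (_+ valNat ds) (NP.*-identityˡ (F (suc j))))
                                                                   (NP.*-identityˡ (F (2 + j))) ⟩
  (F (suc j) + valNat ds) ⊖ (F (suc j) + F j)           ≡⟨ ZP.+-cancelˡ-⊖ (F (suc j)) (valNat ds) (F j) ⟩
  valNat ds ⊖ F j                                       ≡⟨ sym (ZP.-m+n≡n⊖m (F j) (valNat ds)) ⟩
  Z.- (+ F j) Z.+ + valNat ds                           ∎
  where open ≡-Reasoning

odd-length : ∀ d m k → 2 ∣ k → ∃ λ j → length (d ∷ digits m k) ≡ suc (2 * j)
odd-length d m k (divides q k≡q*2) = q , cong suc (trans (length-digits m k) (trans k≡q*2 (NP.*-comm q 2)))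

lengths≡0⇒++≡[] : ∀ (u v : List A) → length u ≡ 0 → length v ≡ 0 → u ++ v ≡ []
lengths≡0⇒++≡[] []      []      _ _ = refl
lengths≡0⇒++≡[] []      (_ ∷ _) _ ()
lengths≡0⇒++≡[] (_ ∷ _) _       () _

Zeckendorf⇒InL : ∀ {w} → Zeckendorf w → (∃ λ j → length w ≡ suc (2 * j)) →
                 ¬ (∃ λ v → w ≡ 0 ∷ 0 ∷ 0 ∷ v) → ¬ (∃ λ v → w ≡ 1 ∷ 0 ∷ 1 ∷ v) → InL w
Zeckendorf⇒InL z odd no000 no101 = Zeckendorf⇒All≤1 z , odd , Zeckendorf⇒NoFactor11 z , no000 , no101

RepGamma-pos⇒RepFc : ∀ n k m as → 2 ∣ 2 + k → Admissible a (2 + k) m as → m (suc k) ++ m k ≢ [] →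
                     seg (+ 0) (suc n) ≡ expand m (2 + k) → RepFc (+ suc n) (0 ∷ digits m (2 + k))
RepGamma-pos⇒RepFc n k m as 2∣K adm top≢[] seg≡ =
  Zeckendorf⇒InL (0∷ z) (odd-length 0 m K 2∣K) no000 (λ { (_ , ()) }) ,
  (begin
    valFc (0 ∷ digits m K)        ≡⟨ valFc-0∷ (digits m K) ⟩
    + valNat (digits m K)         ≡⟨ cong +_ (sym (length-expand K NP.≤-refl)) ⟩
    + length (expand m K)         ≡⟨ cong (+_ ∘ length) (sym seg≡) ⟩
    + length (seg (+ 0) (suc n))  ≡⟨ cong +_ (length-seg (+ 0) (suc n)) ⟩
    + suc n                       ∎)
  where
  open ≡-Reasoning
  open AdmissibleSequence {x = a} adm
  K = 2 + k
  z : Zeckendorf (digits m K)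
  z = digits-Zeckendorf K NP.≤-refl
  no000 : ¬ (∃ λ v → 0 ∷ digits m K ≡ 0 ∷ 0 ∷ 0 ∷ v)
  no000 (v , eq) = top≢[] (lengths≡0⇒++≡[] (m (suc k)) (m k)
    (LP.∷-injectiveˡ (LP.∷-injectiveʳ eq)) (LP.∷-injectiveˡ (LP.∷-injectiveʳ (LP.∷-injectiveʳ eq))))

RepGamma-neg⇒RepFc : ∀ n k ℓ m as → 2 ∣ 2 + k → Admissible b (2 + k) m as →
                     φ^ 1 (m (suc k)) ++ φ^ 0 (m k) ++ [ as k ] ≢ a ∷ b ∷ [] →
                     -[1+ suc n ] ≡ Z.- (+ length (φ^ (2 + k) [ b ])) Z.+ + ℓ →
                     seg (Z.- (+ length (φ^ (2 + k) [ b ]))) ℓ ≡ expand m (2 + k) →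
                     RepFc (-[1+ suc n ]) (1 ∷ digits m (2 + k))
RepGamma-neg⇒RepFc n k ℓ m as 2∣K adm ≢ab n≡ seg≡ =
  Zeckendorf⇒InL z (odd-length 1 m K 2∣K) (λ { (_ , ()) }) no101 ,
  (begin
    valFc (1 ∷ digits m K)                             ≡⟨ valFc-1∷ (digits m K) (length-digits m K) ⟩
    Z.- (+ F (suc k)) Z.+ + valNat (digits m K)        ≡⟨ cong₂ (λ L ℓ′ → Z.- (+ L) Z.+ + ℓ′) (sym (length-φ^-b (suc k))) (sym ℓ≡) ⟩
    Z.- (+ length (φ^ K [ b ])) Z.+ + ℓ                ≡⟨ sym n≡ ⟩
    -[1+ suc n ]                                       ∎)
  where
  open ≡-Reasoning
  open AdmissibleSequence {x = b} adm
  K = 2 + k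
  -- φ(b) = a, so the pair of highest index is (ε, a) and the digit word starts with 10.
  m-top≡[] : m (suc k) ≡ []
  m-top≡[] = pair-shape-b (proj₂ adm)
  z : Zeckendorf (1 ∷ digits m K)
  z = subst (λ w → Zeckendorf (1 ∷ length w ∷ digits m (suc k))) (sym m-top≡[])
        (10∷ Zeckendorf-tail (digits-Zeckendorf K NP.≤-refl))
  ℓ≡ : ℓ ≡ valNat (digits m K)
  ℓ≡ = trans (sym (length-seg _ ℓ)) (trans (cong length seg≡) (length-expand K NP.≤-refl))
  no101 : ¬ (∃ λ v → 1 ∷ digits m K ≡ 1 ∷ 0 ∷ 1 ∷ v)
  no101 (v , eq) with pair-shape-at k (NP.m<n⇒m<1+n (NP.n<1+n k))
  ... | inj₁ (m≡[] , _)   = NP.0≢1+n (trans (cong length (sym m≡[])) (LP.∷-injectiveˡ (LP.∷-injectiveʳ (LP.∷-injectiveʳ eq))))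
  ... | inj₂ (m≡a , as≡b) = ≢ab (trans (cong₂ (λ u w → φ^ 1 u ++ w ++ [ as k ]) m-top≡[] m≡a) (cong (λ c → a ∷ c ∷ []) as≡b))

RepGamma⇒RepFc : ∀ {n w} → RepGamma n w → RepFc n w
RepGamma⇒RepFc rep-zero =
  Zeckendorf⇒InL (0∷ ε) (0 , refl) (λ { (_ , ()) }) (λ { (_ , ()) }) , refl
RepGamma⇒RepFc rep-minus1 =
  Zeckendorf⇒InL 1ε (0 , refl) (λ { (_ , ()) }) (λ { (_ , ()) }) , refl
RepGamma⇒RepFc (rep-pos n (suc (suc k)) m as 2∣K (s≤s (s≤s z≤n)) adm top≢[] seg≡) =
  RepGamma-pos⇒RepFc n k m as 2∣K adm top≢[] seg≡
RepGamma⇒RepFc (rep-neg n (suc (suc k)) ℓ m as 2∣K (s≤s (s≤s z≤n)) adm ≢ab n≡ seg≡) =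
  RepGamma-neg⇒RepFc n k ℓ m as 2∣K adm ≢ab n≡ seg≡

valNat-top-two-pos : ∀ d₁ d₂ rest → ¬ (d₁ ≡ 0 × d₂ ≡ 0) → 0 < valNat (d₁ ∷ d₂ ∷ rest)
valNat-top-two-pos zero     zero     rest ¬00 = ⊥-elim (¬00 (refl , refl))
valNat-top-two-pos zero     (suc d₂) rest _   = valNat-pos (suc d₂) rest (s≤s z≤n)
valNat-top-two-pos (suc d₁) d₂       rest _   = valNat-pos (suc d₁) (d₂ ∷ rest) (s≤s z≤n)

block-++≡[]⇒≡0 : ∀ d d′ → block d ++ block d′ ≡ [] → d ≡ 0 × d′ ≡ 0
block-++≡[]⇒≡0 zero    zero    _  = refl , refl
block-++≡[]⇒≡0 zero    (suc _) ()
block-++≡[]⇒≡0 (suc _) _       ()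

RepGamma-valFc-0∷ : ∀ d₁ d₂ rest → 2 ∣ length (d₁ ∷ d₂ ∷ rest) → Zeckendorf (d₁ ∷ d₂ ∷ rest) →
              ¬ (d₁ ≡ 0 × d₂ ≡ 0) → RepGamma (valFc (0 ∷ d₁ ∷ d₂ ∷ rest)) (0 ∷ d₁ ∷ d₂ ∷ rest)
RepGamma-valFc-0∷ d₁ d₂ rest 2∣K z ¬00 =
  subst₂ RepGamma value word (rep-pos (pred v) K m as 2∣K (s≤s (s≤s z≤n)) adm top≢[] seg≡)
  where
  ds = d₁ ∷ d₂ ∷ rest
  K = length ds
  m = mSeq ds
  as = aSeq ds
  v = valNat ds
  adm : Admissible a K m as
  adm = mSeq-Admissible a d₁ (d₂ ∷ rest) z (block-letter-Prefix-φa d₁)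
  1+pred-v : suc (pred v) ≡ v
  1+pred-v = NP.suc-pred v {{>-nonZero (valNat-top-two-pos d₁ d₂ rest ¬00)}}
  top≢[] : m (suc (length rest)) ++ m (length rest) ≢ []
  top≢[] eq = ¬00 (block-++≡[]⇒≡0 d₁ d₂
    (subst₂ (λ e e′ → block e ++ block e′ ≡ []) (digit-top d₁ (d₂ ∷ rest))
            (trans (digit-below d₁ (d₂ ∷ rest) (NP.n<1+n _)) (digit-top d₂ rest)) eq))
  seg≡ : seg (+ 0) (suc (pred v)) ≡ expand m K
  seg≡ = subst (λ ℓ → seg (+ 0) ℓ ≡ expand m K)
           (trans (length-expand-mSeq a adm (Zeckendorf⇒All≤1 z)) (sym 1+pred-v))
           (seg-Prefix-φ^-a K (expand-Prefix a adm))
  value : + suc (pred v) ≡ valFc (0 ∷ ds)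
  value = trans (cong +_ 1+pred-v) (sym (valFc-0∷ ds))
  word : 0 ∷ digits m K ≡ 0 ∷ ds
  word = cong (0 ∷_) (digits-mSeq ds (Zeckendorf⇒All≤1 z))

RepGamma-valFc-100∷ : ∀ rest → 2 ∣ length (0 ∷ 0 ∷ rest) → Zeckendorf rest →
               RepGamma (valFc (1 ∷ 0 ∷ 0 ∷ rest)) (1 ∷ 0 ∷ 0 ∷ rest)
RepGamma-valFc-100∷ rest 2∣K@(divides j K≡j*2) z =
  subst₂ RepGamma value word (rep-neg n K ℓ m as 2∣K (s≤s (s≤s z≤n)) adm ≢ab n≡ seg≡)
  where
  ds = 0 ∷ 0 ∷ rest
  K = length ds
  m = mSeq ds
  as = aSeq ds
  adm : Admissible b K m as
  adm = mSeq-Admissible b 0 (0 ∷ rest) (0∷ 0∷ z) ([] , refl)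
  ℓ = length (expand m K)
  L = length (φ^ K [ b ])
  ℓ≡ : ℓ ≡ valNat rest
  ℓ≡ = length-expand-mSeq b adm (Zeckendorf⇒All≤1 (0∷ 0∷ z))
  L≡ : L ≡ F (suc (length rest))
  L≡ = length-φ^-b (suc (length rest))
  2+ℓ≤L : 2 + ℓ ≤ L
  2+ℓ≤L = subst₂ (λ ℓ′ L′ → 2 + ℓ′ ≤ L′) (sym ℓ≡) (sym L≡)
            (NP.≤-trans (s≤s (valNat-Zeckendorf< z)) (F-<-suc (length rest)))
  n = L ∸ (2 + ℓ)
  L≡ℓ+2+n : L ≡ ℓ + suc (suc n)
  L≡ℓ+2+n = trans (sym (NP.m+[n∸m]≡n 2+ℓ≤L)) (sym (trans (NP.+-suc ℓ (suc n)) (cong suc (NP.+-suc ℓ n))))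
  n≡ : -[1+ suc n ] ≡ Z.- (+ L) Z.+ + ℓ
  n≡ = sym (trans (cong (λ L′ → Z.- (+ L′) Z.+ + ℓ) L≡ℓ+2+n) (-[m+1+n]+m≡-[1+n] ℓ (suc n)))
  ≢ab : φ^ 1 (m (suc (length rest))) ++ φ^ 0 (m (length rest)) ++ [ as (length rest) ] ≢ a ∷ b ∷ []
  ≢ab eq with subst₂ (λ e e′ → φ^ 1 (block e) ++ block e′ ++ [ letter e′ ] ≡ a ∷ b ∷ [])
                     (digit-top 0 (0 ∷ rest)) (trans (digit-below 0 (0 ∷ rest) (NP.n<1+n _)) (digit-top 0 rest)) eq
  ... | ()
  K≡2*j : K ≡ 2 * j
  K≡2*j = trans K≡j*2 (NP.*-comm j 2)
  seg≡ : seg (Z.- (+ L)) ℓ ≡ expand m K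
  seg≡ = subst (λ k → seg (Z.- (+ length (φ^ k [ b ]))) ℓ ≡ expand m K) (sym K≡2*j)
           (seg-Prefix-φ^-b j (subst (λ k → Prefix (expand m K) (φ^ k [ b ])) K≡2*j (expand-Prefix b adm)))
  value : -[1+ suc n ] ≡ valFc (1 ∷ ds)
  value = trans n≡ (trans (cong₂ (λ L′ ℓ′ → Z.- (+ L′) Z.+ + ℓ′) L≡ ℓ≡) (sym (valFc-1∷ ds refl)))
  word : 1 ∷ digits m K ≡ 1 ∷ ds
  word = cong (1 ∷_) (digits-mSeq ds (Zeckendorf⇒All≤1 (0∷ 0∷ z)))

even-tail : ∀ (ds : List ℕ) j → suc (length ds) ≡ suc (2 * j) → 2 ∣ length ds
even-tail ds j odd = divides j (trans (NP.suc-injective odd) (NP.*-comm 2 j))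

InL⇒RepGamma : ∀ w → InL w → RepGamma (valFc w) w
InL⇒RepGamma []                     (_ , (_ , ()) , _)
InL⇒RepGamma (zero ∷ [])            _ = rep-zero
InL⇒RepGamma (suc zero ∷ [])        _ = rep-minus1
InL⇒RepGamma (suc (suc _) ∷ _)      (s≤s () ∷ _ , _)
InL⇒RepGamma (_ ∷ d ∷ [])           (_ , (j , odd) , _) with ∣1⇒≡1 (even-tail (d ∷ []) j odd)
... | ()
InL⇒RepGamma (zero ∷ d₁ ∷ d₂ ∷ rest) (≤1 , (j , odd) , no11 , no000 , _) =
  RepGamma-valFc-0∷ d₁ d₂ rest (even-tail (d₁ ∷ d₂ ∷ rest) j odd)
    (Zeckendorf-tail (All≤1∧NoFactor11⇒Zeckendorf _ ≤1 no11)) (λ { (refl , refl) → no000 (rest , refl) })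
InL⇒RepGamma (suc zero ∷ d₁ ∷ d₂ ∷ rest) (≤1 , (j , odd) , no11 , _ , no101)
  with All≤1∧NoFactor11⇒Zeckendorf _ ≤1 no11
... | 10∷ 0∷ z     = RepGamma-valFc-100∷ rest (even-tail (d₁ ∷ d₂ ∷ rest) j odd) z
... | 10∷ 1ε       = ⊥-elim (no101 ([] , refl))
... | 10∷ (10∷ _)  = ⊥-elim (no101 (_ , refl))

proposition24 : (n : ℤ) (w : List ℕ) → RepGamma n w ⇔ RepFc n w
proposition24 n w = mk⇔ RepGamma⇒RepFc (λ { (w∈L , refl) → InL⇒RepGamma w w∈L })
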